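{- Let $\Pi\subseteq S_3$ be nonempty and let $\sigma\in S_3$. Then $\mathrm{ETP}[\Pi]=\mathrm{ETP}[\sigma\Pi]$, and consequently $p_\Pi(n)=p_{\sigma\Pi}(n)$ for all $n\ge3$. Here $\sigma\Pi=\{\sigma\circ\pi:\pi\in\Pi\}$.
   Context: Permutations $\pi\in S_3$ are written as words $\pi(1)\pi(2)\pi(3)$. Then $\sigma\circ\pi$ is the word $\sigma(\pi(1))\sigma(\pi(2))\sigma(\pi(3))$. An ordering on $[n]$ is a bijection $\phi:[n]\to[n]$. A ternary constraint is a triple $\mathbf x=(x_1,x_2,x_3)$ of distinct elements of $[n]$. $\mathrm{ord}(\phi,\mathbf x)$ is the word $abc\in S_3$ with $\phi(x_a)<\phi(x_b)<\phi(x_c)$. For nonempty $\Pi\subseteq S_3$, $\mathrm{ETP}[\Pi]$ is the set of sets $\Phi$ of orderings on $[n]$ such that for every constraint $\mathbf x$ some $\phi\in\Phi$ has $\mathrm{ord}(\phi,\mathbf x)\in\Pi$. $p_\Pi(n)$ is the minimum size of a member of $\mathrm{ETP}[\Pi]$. -}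

module Defs where

open import Data.Nat using (ℕ; _≤_)
open import Data.Fin using (Fin; zero; suc; _<_)
open import Data.Vec using (Vec; lookup; map)
open import Data.List using (List; length)
open import Data.List.Membership.Propositional using (_∈_)
open import Data.List.Relation.Unary.AllPairs using (AllPairs)
open import Data.Product using (Σ; ∃; _×_; _,_)
open import Data.Fin.Permutation using (Permutation′; _⟨$⟩ʳ_)
open import Relation.Binary.PropositionalEquality using (_≡_)
open import Relation.Nullary using (¬_)

-- Convention: [3] = {1,2,3} is represented by Fin 3 = {0,1,2}, [n] by Fin n.

-- A word of length 3 over [3]: π(1)π(2)π(3) is the vector (π 0, π 1, π 2).
Word : Set
Word = Vec (Fin 3) 3

Distinct : {A : Set} → Vec A 3 → Set
Distinct v = ∀ i j → lookup v i ≡ lookup v j → i ≡ j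

IsS3 : Word → Set
IsS3 = Distinct

-- A subset of S₃ is given by a predicate on words (supported on S₃).
SubsetS3 : Set₁
SubsetS3 = Word → Set

_·_ : Word → SubsetS3 → SubsetS3
(σ · Π) w = Σ Word λ π → Π π × (w ≡ map (lookup σ) π)

Ordering : ℕ → Set
Ordering n = Permutation′ n

Constraint : ℕ → Set
Constraint n = Σ (Vec (Fin n) 3) Distinct

OrdIs : {n : ℕ} → Ordering n → Constraint n → Word → Set
OrdIs φ (x , _) w =
  (φ ⟨$⟩ʳ lookup x (lookup w zero)) < (φ ⟨$⟩ʳ lookup x (lookup w (suc zero))) ×
  (φ ⟨$⟩ʳ lookup x (lookup w (suc zero))) < (φ ⟨$⟩ʳ lookup x (lookup w (suc (suc zero))))

SameOrdering : {n : ℕ} → Ordering n → Ordering n → Set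
SameOrdering φ ψ = ∀ i → φ ⟨$⟩ʳ i ≡ ψ ⟨$⟩ʳ i

-- A finite set of orderings on [n]: a duplicate-free list; its size is its length.
record OrderingSet (n : ℕ) : Set where
  field
    elems    : List (Ordering n)
    distinct : AllPairs (λ φ ψ → ¬ SameOrdering φ ψ) elems

open OrderingSet public

size : {n : ℕ} → OrderingSet n → ℕ
size Φ = length (elems Φ)

InETP : SubsetS3 → {n : ℕ} → OrderingSet n → Set
InETP Π {n} Φ = ∀ (x : Constraint n) →
  Σ (Ordering n) λ φ → φ ∈ elems Φ × Σ Word λ w → OrdIs φ x w × Π w

IsPValue : SubsetS3 → ℕ → ℕ → Set
IsPValue Π n k =
  (Σ (OrderingSet n) λ Φ → InETP Π Φ × size Φ ≡ k) ×
  (∀ (Φ : OrderingSet n) → InETP Π Φ → k ≤ size Φ)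

module Submission where

-- For a constraint x = (x₁,x₂,x₃) and a permutation ρ ∈ S₃, the relabelled
-- triple x∘ρ = (x_{ρ1}, x_{ρ2}, x_{ρ3}) is again a constraint, and an ordering
-- φ that sees x∘ρ in the pattern π sees x in the pattern ρ∘π.  Hence, if
-- ρ∘π ∈ Π' for every π ∈ Π, every member of ETP[Π] is a member of ETP[Π']:
-- to cover x for Π', cover x∘ρ for Π.  Applying this with ρ = σ gives
-- ETP[Π] ⊆ ETP[σΠ]; applying it with ρ = σ⁻¹ gives the reverse inclusion.
-- The inverse σ⁻¹ exists because an injective endomap of a finite set Fin n
-- is surjective (a pigeonhole argument).  Finally p_Π(n) depends on Π only
-- through the family of sets ETP[Π], so equal ETP families give equal
-- p-values.

open import Defs
open import Data.Nat using (ℕ; _≤_)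
open import Data.Nat.Properties using (1+n≰n)
open import Data.Fin using (Fin; _<_; _≟_; punchOut)
open import Data.Fin.Properties using (any?; injective⇒≤; punchOut-injective)
open import Data.Fin.Permutation using (_⟨$⟩ʳ_)
open import Data.Vec using (Vec; lookup; map; tabulate)
open import Data.Vec.Properties using (lookup-map; lookup∘tabulate; map-∘; map-cong; map-id)
open import Data.Product using (Σ; ∃; _×_; _,_; proj₁; proj₂)
open import Function.Bundles using (_⇔_; mk⇔; Equivalence)
open import Function.Properties.Equivalence using () renaming (sym to ⇔-sym)
open import Function.Definitions using (Injective)
open import Relation.Nullary using (yes; no; contradiction)
open import Relation.Binary.PropositionalEquality
  using (_≡_; _≢_; refl; sym; trans; cong; subst; subst₂; module ≡-Reasoning)

-- Pigeonhole: an injective map Fin n → Fin n is surjective.  Otherwise it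
-- would miss some i, and punching out i would inject Fin n into Fin (n - 1).
injective⇒surjective : {n : ℕ} {f : Fin n → Fin n} →
  Injective _≡_ _≡_ f → ∀ i → ∃ λ j → f j ≡ i
injective⇒surjective {ℕ.suc m} {f} f-inj i with any? (λ j → f j ≟ i)
... | yes hit  = hit
... | no  miss = contradiction (injective⇒≤ squeeze-injective) 1+n≰n
  where
  avoids : ∀ j → i ≢ f j
  avoids j i≡fj = miss (j , sym i≡fj)

  squeeze : Fin (ℕ.suc m) → Fin m
  squeeze j = punchOut (avoids j)

  squeeze-injective : Injective _≡_ _≡_ squeeze
  squeeze-injective eq = f-inj (punchOut-injective (avoids _) (avoids _) eq)

distinct⇒injective : {A : Set} {v : Vec A 3} → Distinct v → Injective _≡_ _≡_ (lookup v)
distinct⇒injective d {i} {j} = d i j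

inverse : (σ : Word) → IsS3 σ →
  Σ Word λ τ → IsS3 τ × (∀ (π : Word) → map (lookup τ) (map (lookup σ) π) ≡ π)
inverse σ dσ = τ , τ-distinct , τ∘σ≡id
  where
  surjective : ∀ i → ∃ λ j → lookup σ j ≡ i
  surjective = injective⇒surjective (distinct⇒injective {v = σ} dσ)

  preimage : Fin 3 → Fin 3
  preimage i = proj₁ (surjective i)

  τ : Word
  τ = tabulate preimage

  σ∘τ : ∀ i → lookup σ (lookup τ i) ≡ i
  σ∘τ i = trans (cong (lookup σ) (lookup∘tabulate preimage i))
                (proj₂ (surjective i))

  τ∘σ : ∀ j → lookup τ (lookup σ j) ≡ j
  τ∘σ j = dσ _ j (σ∘τ (lookup σ j))

  τ-distinct : IsS3 τ
  τ-distinct i j eq = trans (sym (σ∘τ i)) (trans (cong (lookup σ) eq) (σ∘τ j))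

  τ∘σ≡id : ∀ (π : Word) → map (lookup τ) (map (lookup σ) π) ≡ π
  τ∘σ≡id π = begin
    map (lookup τ) (map (lookup σ) π)        ≡⟨ sym (map-∘ (lookup τ) (lookup σ) π) ⟩
    map (λ j → lookup τ (lookup σ j)) π      ≡⟨ map-cong τ∘σ π ⟩
    map (λ j → j) π                          ≡⟨ map-id π ⟩
    π                                        ∎
    where open ≡-Reasoning

relabel : {n : ℕ} → Constraint n → (ρ : Word) → IsS3 ρ → Constraint n
relabel (x , dx) ρ dρ = map (lookup x) ρ , relabelled-distinct
  where
  relabelled-distinct : Distinct (map (lookup x) ρ)
  relabelled-distinct i j eq = dρ i j (dx _ _ (begin
    lookup x (lookup ρ i)          ≡⟨ sym (lookup-map i (lookup x) ρ) ⟩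
    lookup (map (lookup x) ρ) i    ≡⟨ eq ⟩
    lookup (map (lookup x) ρ) j    ≡⟨ lookup-map j (lookup x) ρ ⟩
    lookup x (lookup ρ j)          ∎))
    where open ≡-Reasoning

-- ord(φ, x∘ρ) = π  implies  ord(φ, x) = ρ∘π: position k of π in x∘ρ is the
-- element x_{ρ(π k)}, which is position k of ρ∘π in x.
ord-relabel : {n : ℕ} (φ : Ordering n) (x : Constraint n) (ρ : Word) (dρ : IsS3 ρ)
  (π : Word) → OrdIs φ (relabel x ρ dρ) π → OrdIs φ x (map (lookup ρ) π)
ord-relabel φ (x , _) ρ _ π (first , second) = reindex first , reindex second
  where
  same-entry : ∀ k →
    lookup (map (lookup x) ρ) (lookup π k) ≡ lookup x (lookup (map (lookup ρ) π) k)
  same-entry k = trans (lookup-map (lookup π k) (lookup x) ρ)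
                       (cong (lookup x) (sym (lookup-map k (lookup ρ) π)))

  reindex : ∀ {k l} →
    (φ ⟨$⟩ʳ lookup (map (lookup x) ρ) (lookup π k)) < (φ ⟨$⟩ʳ lookup (map (lookup x) ρ) (lookup π l)) →
    (φ ⟨$⟩ʳ lookup x (lookup (map (lookup ρ) π) k)) < (φ ⟨$⟩ʳ lookup x (lookup (map (lookup ρ) π) l))
  reindex {k} {l} = subst₂ (λ u v → (φ ⟨$⟩ʳ u) < (φ ⟨$⟩ʳ v)) (same-entry k) (same-entry l)

-- Transfer along ρ: if ρ∘π ∈ Π' for all π ∈ Π, then ETP[Π] ⊆ ETP[Π'].
-- The constraint x is covered for Π' by the ordering covering x∘ρ for Π.
etp-transfer : (Π Π' : SubsetS3) (ρ : Word) → IsS3 ρ →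
  (∀ π → Π π → Π' (map (lookup ρ) π)) →
  {n : ℕ} (Φ : OrderingSet n) → InETP Π Φ → InETP Π' Φ
etp-transfer Π Π' ρ dρ ρΠ⊆Π' Φ covers x with covers (relabel x ρ dρ)
... | φ , φ∈Φ , π , ord≡π , π∈Π =
  φ , φ∈Φ , map (lookup ρ) π , ord-relabel φ x ρ dρ π ord≡π , ρΠ⊆Π' π π∈Π

pvalue-transfer : (Π Π' : SubsetS3) (n k : ℕ) →
  (∀ (Φ : OrderingSet n) → InETP Π Φ ⇔ InETP Π' Φ) →
  IsPValue Π n k → IsPValue Π' n k
pvalue-transfer Π Π' n k same ((Φ , Φ∈ETP , size≡k) , minimal) =
  (Φ , Equivalence.to (same Φ) Φ∈ETP , size≡k) ,
  λ Ψ Ψ∈ETP' → minimal Ψ (Equivalence.from (same Ψ) Ψ∈ETP')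

pvalue-invariant : (Π Π' : SubsetS3) (n k : ℕ) →
  (∀ (Φ : OrderingSet n) → InETP Π Φ ⇔ InETP Π' Φ) →
  IsPValue Π n k ⇔ IsPValue Π' n k
pvalue-invariant Π Π' n k same = mk⇔
  (pvalue-transfer Π Π' n k same)
  (pvalue-transfer Π' Π n k (λ Φ → ⇔-sym (same Φ)))

-- Proposition 4.2: ETP[Π] = ETP[σΠ], hence p_Π(n) = p_{σΠ}(n).
proposition4p2 : (Π : SubsetS3) → (∀ w → Π w → IsS3 w) → Σ Word Π →
    (σ : Word) → IsS3 σ →
    (∀ (n : ℕ) (Φ : OrderingSet n) → InETP Π Φ ⇔ InETP (σ · Π) Φ) ×
    (∀ (n : ℕ) → 3 ≤ n → ∀ (k : ℕ) → IsPValue Π n k ⇔ IsPValue (σ · Π) n k)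
proposition4p2 Π _ _ σ dσ = etp-equal , λ n _ k → pvalue-invariant Π (σ · Π) n k (etp-equal n)
  where
  τ : Word
  τ = proj₁ (inverse σ dσ)

  dτ : IsS3 τ
  dτ = proj₁ (proj₂ (inverse σ dσ))

  τ∘σ≡id : ∀ (π : Word) → map (lookup τ) (map (lookup σ) π) ≡ π
  τ∘σ≡id = proj₂ (proj₂ (inverse σ dσ))

  σΠ-image : ∀ π → Π π → (σ · Π) (map (lookup σ) π)
  σΠ-image π π∈Π = π , π∈Π , refl

  τσΠ⊆Π : ∀ w → (σ · Π) w → Π (map (lookup τ) w)
  τσΠ⊆Π _ (π , π∈Π , refl) = subst Π (sym (τ∘σ≡id π)) π∈Π

  etp-equal : ∀ (n : ℕ) (Φ : OrderingSet n) → InETP Π Φ ⇔ InETP (σ · Π) Φ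
  etp-equal n Φ = mk⇔ (etp-transfer Π (σ · Π) σ dσ σΠ-image Φ)
                      (etp-transfer (σ · Π) Π τ dτ τσΠ⊆Π Φ)
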